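{- For every fixed integer $k\ge 1$, there are only finitely many (up to isomorphism) $k$-vertex-critical $(P_1+P_3)$-free graphs.
   Context: All graphs are finite and simple. $P_1+P_3$ is the disjoint union of a single vertex and a path on 3 vertices; a graph is $(P_1+P_3)$-free if it has no induced subgraph isomorphic to $P_1+P_3$. A graph $G$ is $k$-vertex-critical if $\chi(G)=k$ and $\chi(G-v)<k$ for every vertex $v$, where $\chi$ is the chromatic number. -}

module Defs where

open import Data.Nat using (ℕ; zero; suc; _<_)
open import Data.Fin using (Fin; punchIn)
open import Data.Fin.Patterns using (0F; 1F; 2F; 3F)
open import Data.Bool using (Bool; true; false)
open import Data.Product using (Σ; ∃; _×_; _,_)
open import Data.List using (List)
open import Data.List.Membership.Propositional using (_∈_)
open import Function.Bundles using (_↔_; Inverse)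
open import Function.Definitions using (Injective)
open import Relation.Binary.PropositionalEquality using (_≡_; _≢_)
open import Relation.Nullary using (¬_)

record Graph (n : ℕ) : Set where
  field
    adj    : Fin n → Fin n → Bool
    sym    : ∀ u v → adj u v ≡ adj v u
    irrefl : ∀ v → adj v v ≡ false
open Graph public

Adjacent : ∀ {n} → Graph n → Fin n → Fin n → Set
Adjacent G u v = adj G u v ≡ true

Colorable : ∀ {n} → Graph n → ℕ → Set
Colorable {n} G c = Σ (Fin n → Fin c) λ f → ∀ u v → Adjacent G u v → f u ≢ f v

ChromaticNumberIs : ∀ {n} → Graph n → ℕ → Set
ChromaticNumberIs G k = Colorable G k × (∀ c → c < k → ¬ Colorable G c)

ChromaticNumberBelow : ∀ {n} → Graph n → ℕ → Set
ChromaticNumberBelow G k = Σ ℕ λ c → c < k × Colorable G c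

deleteVertex : ∀ {m} → Graph (suc m) → Fin (suc m) → Graph m
deleteVertex G v = record
  { adj    = λ a b → adj G (punchIn v a) (punchIn v b)
  ; sym    = λ a b → sym G (punchIn v a) (punchIn v b)
  ; irrefl = λ a → irrefl G (punchIn v a)
  }

VertexCritical : ∀ {n} → Graph n → ℕ → Set
VertexCritical {zero}  G k = ChromaticNumberIs G k
VertexCritical {suc m} G k =
  ChromaticNumberIs G k × (∀ v → ChromaticNumberBelow (deleteVertex G v) k)

ContainsInduced : ∀ {m n} → Graph m → Graph n → Set
ContainsInduced {m} {n} H G =
  Σ (Fin m → Fin n) λ f → Injective _≡_ _≡_ f × (∀ i j → adj H i j ≡ adj G (f i) (f j))

P1+P3-adj : Fin 4 → Fin 4 → Bool
P1+P3-adj 1F 2F = true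
P1+P3-adj 2F 1F = true
P1+P3-adj 2F 3F = true
P1+P3-adj 3F 2F = true
P1+P3-adj _  _  = false

P1+P3 : Graph 4
P1+P3 = record { adj = P1+P3-adj ; sym = s ; irrefl = i }
  where
  open import Relation.Binary.PropositionalEquality using (refl)
  s : ∀ u v → P1+P3-adj u v ≡ P1+P3-adj v u
  s 0F 0F = refl
  s 0F 1F = refl
  s 0F 2F = refl
  s 0F 3F = refl
  s 1F 0F = refl
  s 1F 1F = refl
  s 1F 2F = refl
  s 1F 3F = refl
  s 2F 0F = refl
  s 2F 1F = refl
  s 2F 2F = refl
  s 2F 3F = refl
  s 3F 0F = refl
  s 3F 1F = refl
  s 3F 2F = refl
  s 3F 3F = refl
  i : ∀ v → P1+P3-adj v v ≡ false
  i 0F = refl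
  i 1F = refl
  i 2F = refl
  i 3F = refl

P1+P3-Free : ∀ {n} → Graph n → Set
P1+P3-Free G = ¬ ContainsInduced P1+P3 G

Isomorphic : ∀ {m n} → Graph m → Graph n → Set
Isomorphic {m} {n} G H =
  Σ (Fin m ↔ Fin n) λ φ → ∀ u v → adj G u v ≡ adj H (Inverse.to φ u) (Inverse.to φ v)

AnyGraph : Set
AnyGraph = Σ ℕ Graph

-- In a vertex-critical (P1+P3)-free graph no three vertices a, b, c are
-- pairwise non-adjacent.  Otherwise freeness forces the private neighbours of
-- b (adjacent to b but not to a) to form, together with b, a clique complete
-- to the common neighbours of a and b.  If a has at most as many private
-- neighbours as b, this clique carries more colours in a colouring of G - a
-- than the private neighbours of a can use, and none of the colours of the
-- common neighbours; one of its colours is therefore free for a, contradicting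
-- criticality.  Hence every colour class has at most two vertices, a
-- k-critical graph has at most 2k vertices, and there are finitely many
-- graphs of that order.
module Submission where

open import Defs
open import Data.Bool using (Bool; true; false; _∧_)
open import Data.Bool.Properties using (∧-idem; ∧-comm) renaming (_≟_ to _≟ᵇ_)
open import Data.Empty using (⊥; ⊥-elim)
open import Data.Fin as Fin using (Fin; punchOut; combine)
open import Data.Fin.Patterns using (0F; 1F; 2F; 3F)
open import Data.Fin.Properties
  using (_≟_; any?; all?; ¬∀⟶∃¬; pigeonhole; punchIn-punchOut; <⇒≢; <-trans;
         <-cmp; _<?_; combine-injective; injective⇒≤)
open import Data.List using (List; []; _∷_; length; lookup; filter; allFin;
  map; concatMap; cartesianProductWith; upTo)
open import Data.List.Membership.Propositional using (_∈_; lose)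
open import Data.List.Membership.Propositional.Properties
  using (∈-lookup; ∈-filter⁺; ∈-filter⁻; ∈-allFin; ∈-map⁺;
         ∈-cartesianProductWith⁺; ∈-concatMap⁺; ∈-upTo⁺)
import Data.List.Relation.Unary.All as All
open import Data.List.Relation.Unary.AllPairs using (_∷_)
import Data.List.Relation.Unary.Any as Any
open import Data.List.Relation.Unary.Any using (here; there)
open import Data.List.Relation.Unary.Any.Properties using (lookup-index)
open import Data.List.Relation.Unary.Unique.Propositional using (Unique)
open import Data.List.Relation.Unary.Unique.Propositional.Properties
  using (allFin⁺) renaming (filter⁺ to unique-filter⁺)
open import Data.Nat using (ℕ; zero; suc; _≤_; _<_; _≥_; _*_; s≤s)
open import Data.Nat.Properties using (≤-total)
open import Data.Product using (Σ; ∃-syntax; _×_; _,_; proj₁; proj₂)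
open import Data.Sum using ([_,_]′)
open import Data.Vec as Vec using (Vec; tabulate)
open import Data.Vec.Functional using (insertAt; updateAt)
open import Data.Vec.Functional.Properties
  using (insertAt-punchIn; updateAt-updates; updateAt-minimal)
open import Data.Vec.Properties using (lookup∘tabulate)
open import Function using (_∘_; const; case_of_)
open import Function.Construct.Identity using (↔-id)
open import Relation.Binary.Definitions using (DecidableEquality; tri<; tri≈; tri>)
open import Relation.Binary.PropositionalEquality
  using (_≡_; _≢_; refl; trans; cong; cong₂; subst₂; module ≡-Reasoning)
  renaming (sym to ≡-sym)
open import Relation.Nullary using (¬_; yes; no; contradiction)
open import Relation.Unary using (Decidable)
open import Relation.Nullary.Decidable using (_×-dec_)

module _ {A : Set} where

  Unique⇒lookup-injective : ∀ {xs : List A} → Unique xs →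
                            ∀ i j → lookup xs i ≡ lookup xs j → i ≡ j
  Unique⇒lookup-injective (_ ∷ _)      Fin.zero    Fin.zero    _  = refl
  Unique⇒lookup-injective (x∉xs ∷ _)   Fin.zero    (Fin.suc j) eq =
    contradiction eq (All.lookup x∉xs (∈-lookup j))
  Unique⇒lookup-injective (x∉xs ∷ _)   (Fin.suc i) Fin.zero    eq =
    contradiction (≡-sym eq) (All.lookup x∉xs (∈-lookup i))
  Unique⇒lookup-injective (_ ∷ xs!)    (Fin.suc i) (Fin.suc j) eq =
    cong Fin.suc (Unique⇒lookup-injective xs! i j eq)

  pigeonhole-∉ : ∀ {C : Set} → DecidableEquality C → (g : A → C) {Q As : List A} →
                 Unique Q → (∀ {x y} → x ∈ Q → y ∈ Q → x ≢ y → g x ≢ g y) →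
                 length As < length Q →
                 ∃[ q ] q ∈ Q × (∀ {y} → y ∈ As → g q ≢ g y)
  pigeonhole-∉ _≟ᶜ_ g {Q} {As} Q! g-injective |As|<|Q| = case all? hit? of λ where
      (no ¬all) →
        let i , ¬hit = ¬∀⟶∃¬ _ _ hit? ¬all
        in lookup Q i , ∈-lookup i ,
           λ {_} y∈As eq → ¬hit (Any.index y∈As , trans eq (cong g (lookup-index y∈As)))
      (yes hit) →
        let i , j , i<j , same = pigeonhole |As|<|Q| (proj₁ ∘ hit)
            gQi≡gQj = trans (proj₂ (hit i))
                        (trans (cong (g ∘ lookup As) same) (≡-sym (proj₂ (hit j))))
        in ⊥-elim (g-injective (∈-lookup i) (∈-lookup j)
                     (<⇒≢ i<j ∘ Unique⇒lookup-injective Q! i j) gQi≡gQj)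
    where
    hit? : Decidable (λ i → ∃[ j ] g (lookup Q i) ≡ g (lookup As j))
    hit? i = any? (λ j → g (lookup Q i) ≟ᶜ g (lookup As j))

module _ {n : ℕ} (G : Graph n) where

  NonAdjacent : Fin n → Fin n → Set
  NonAdjacent u v = adj G u v ≡ false

  Independent : Fin n → Fin n → Set
  Independent u v = u ≢ v × NonAdjacent u v

  PrivateNeighbour : Fin n → Fin n → Fin n → Set
  PrivateNeighbour u v x = Adjacent G u x × NonAdjacent v x

  privateNeighbour? : ∀ u v → Decidable (PrivateNeighbour u v)
  privateNeighbour? u v x = (adj G u x ≟ᵇ true) ×-dec (adj G v x ≟ᵇ false)

  privateNeighbours : Fin n → Fin n → List (Fin n)
  privateNeighbours u v = filter (privateNeighbour? u v) (allFin n)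

  NoIndependentTriple : Set
  NoIndependentTriple =
    ∀ {a b c} → Independent a b → Independent a c → Independent b c → ⊥

  ProperAwayFrom : ∀ {c} → Fin n → (Fin n → Fin c) → Set
  ProperAwayFrom a g = ∀ {u v} → a ≢ u → a ≢ v → Adjacent G u v → g u ≢ g v

ColouringsExtend : ∀ {m} → Graph (suc m) → Fin (suc m) → Set
ColouringsExtend G a = ∀ c → Colorable (deleteVertex G a) c → Colorable G c

module GraphProperties {n : ℕ} (G : Graph n) where

  adjacent⇒≢ : ∀ {u v} → Adjacent G u v → u ≢ v
  adjacent⇒≢ {u} uv refl with trans (≡-sym uv) (irrefl G u)
  ... | ()

  adjacent-sym : ∀ {u v} → Adjacent G u v → Adjacent G v u
  adjacent-sym {u} {v} uv = trans (sym G v u) uv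

  nonAdjacent-sym : ∀ {u v} → NonAdjacent G u v → NonAdjacent G v u
  nonAdjacent-sym {u} {v} uv = trans (sym G v u) uv

  independent-sym : ∀ {u v} → Independent G u v → Independent G v u
  independent-sym (u≢v , uv) = u≢v ∘ ≡-sym , nonAdjacent-sym uv

  separated⇒≢ : ∀ {u v w} → Adjacent G u w → NonAdjacent G v w → v ≢ u
  separated⇒≢ uw vw refl with trans (≡-sym uw) vw
  ... | ()

  ∈-privateNeighbours⁺ : ∀ {u v x} → Adjacent G u x → NonAdjacent G v x →
                         x ∈ privateNeighbours G u v
  ∈-privateNeighbours⁺ {u} {v} ux vx =
    ∈-filter⁺ (privateNeighbour? G u v) (∈-allFin _) (ux , vx)

  ∈-privateNeighbours⁻ : ∀ {u v x} → x ∈ privateNeighbours G u v →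
                         PrivateNeighbour G u v x
  ∈-privateNeighbours⁻ {u} {v} = proj₂ ∘ ∈-filter⁻ (privateNeighbour? G u v) {xs = allFin n}

  privateNeighbours-unique : ∀ u v → Unique (privateNeighbours G u v)
  privateNeighbours-unique u v = unique-filter⁺ (privateNeighbour? G u v) (allFin⁺ n)

  sameColour⇒independent : ∀ {c} ((f , proper) : Colorable G c) {u v} →
                           u ≢ v → f u ≡ f v → Independent G u v
  sameColour⇒independent (f , proper) {u} {v} u≢v fu≡fv with adj G u v in uv
  ... | false = u≢v , refl
  ... | true  = contradiction fu≡fv (proper u v uv)

  induces-P1+P3 : ∀ {w x y z} → x ≢ z →
                  NonAdjacent G w x → NonAdjacent G w y → NonAdjacent G w z →
                  Adjacent G x y → Adjacent G y z → NonAdjacent G x z →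
                  ContainsInduced P1+P3 G
  induces-P1+P3 {w} {x} {y} {z} x≢z wx wy wz xy yz xz = f , injective , preserves
    where
    f : Fin 4 → Fin n
    f 0F = w
    f 1F = x
    f 2F = y
    f 3F = z

    w≢x : w ≢ x
    w≢x = separated⇒≢ xy wy
    w≢y : w ≢ y
    w≢y = separated⇒≢ (adjacent-sym xy) wx
    w≢z : w ≢ z
    w≢z = separated⇒≢ (adjacent-sym yz) wy
    x≢y : x ≢ y
    x≢y = adjacent⇒≢ xy
    y≢z : y ≢ z
    y≢z = adjacent⇒≢ yz

    injective : ∀ {i j} → f i ≡ f j → i ≡ j
    injective {0F} {0F} _ = refl
    injective {1F} {1F} _ = refl
    injective {2F} {2F} _ = refl
    injective {3F} {3F} _ = refl
    injective {0F} {1F} e = contradiction e w≢x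
    injective {0F} {2F} e = contradiction e w≢y
    injective {0F} {3F} e = contradiction e w≢z
    injective {1F} {2F} e = contradiction e x≢y
    injective {1F} {3F} e = contradiction e x≢z
    injective {2F} {3F} e = contradiction e y≢z
    injective {1F} {0F} e = contradiction (≡-sym e) w≢x
    injective {2F} {0F} e = contradiction (≡-sym e) w≢y
    injective {3F} {0F} e = contradiction (≡-sym e) w≢z
    injective {2F} {1F} e = contradiction (≡-sym e) x≢y
    injective {3F} {1F} e = contradiction (≡-sym e) x≢z
    injective {3F} {2F} e = contradiction (≡-sym e) y≢z

    preserves : ∀ i j → adj P1+P3 i j ≡ adj G (f i) (f j)
    preserves 0F 0F = ≡-sym (irrefl G w)
    preserves 1F 1F = ≡-sym (irrefl G x)
    preserves 2F 2F = ≡-sym (irrefl G y)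
    preserves 3F 3F = ≡-sym (irrefl G z)
    preserves 0F 1F = ≡-sym wx
    preserves 0F 2F = ≡-sym wy
    preserves 0F 3F = ≡-sym wz
    preserves 1F 2F = ≡-sym xy
    preserves 1F 3F = ≡-sym xz
    preserves 2F 3F = ≡-sym yz
    preserves 1F 0F = trans (preserves 0F 1F) (sym G w x)
    preserves 2F 0F = trans (preserves 0F 2F) (sym G w y)
    preserves 3F 0F = trans (preserves 0F 3F) (sym G w z)
    preserves 2F 1F = trans (preserves 1F 2F) (sym G x y)
    preserves 3F 1F = trans (preserves 1F 3F) (sym G x z)
    preserves 3F 2F = trans (preserves 2F 3F) (sym G y z)

module _ {m : ℕ} (G : Graph (suc m)) (a : Fin (suc m)) where

  open GraphProperties G

  liftColouring : ∀ {c} → Colorable (deleteVertex G a) c → Fin c →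
                  Σ (Fin (suc m) → Fin c) (ProperAwayFrom G a)
  liftColouring {c} (f , proper) γ = g , g-proper
    where
    g : Fin (suc m) → Fin c
    g = insertAt f a γ

    g-punchOut : ∀ {v} (a≢v : a ≢ v) → g v ≡ f (punchOut a≢v)
    g-punchOut {v} a≢v = trans (cong g (≡-sym (punchIn-punchOut a≢v)))
                               (insertAt-punchIn f a γ (punchOut a≢v))

    g-proper : ProperAwayFrom G a g
    g-proper a≢u a≢v uv gu≡gv =
      proper (punchOut a≢u) (punchOut a≢v)
        (subst₂ (Adjacent G) (≡-sym (punchIn-punchOut a≢u)) (≡-sym (punchIn-punchOut a≢v)) uv)
        (trans (≡-sym (g-punchOut a≢u)) (trans gu≡gv (g-punchOut a≢v)))

  recolourAt : ∀ {c} {g : Fin (suc m) → Fin c} → ProperAwayFrom G a g →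
               (γ : Fin c) → (∀ {v} → Adjacent G a v → γ ≢ g v) → Colorable G c
  recolourAt {c} {g} g-proper γ γ-free = h , h-proper
    where
    h : Fin (suc m) → Fin c
    h = updateAt g a (const γ)

    h-at : h a ≡ γ
    h-at = updateAt-updates a g

    h-away : ∀ {v} → a ≢ v → h v ≡ g v
    h-away a≢v = updateAt-minimal _ a g (a≢v ∘ ≡-sym)

    h-proper : ∀ u v → Adjacent G u v → h u ≢ h v
    h-proper u v uv with a ≟ u | a ≟ v
    ... | yes refl | yes refl = contradiction refl (adjacent⇒≢ uv)
    ... | yes refl | no a≢v   = λ eq → γ-free uv (trans (≡-sym h-at) (trans eq (h-away a≢v)))
    ... | no a≢u   | yes refl =
      λ eq → γ-free (adjacent-sym uv) (trans (≡-sym h-at) (trans (≡-sym eq) (h-away a≢u)))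
    ... | no a≢u   | no a≢v   =
      λ eq → g-proper a≢u a≢v uv (trans (≡-sym (h-away a≢u)) (trans eq (h-away a≢v)))

colouringsExtend : ∀ {m} {G : Graph (suc m)} {a b} → Independent G a b →
  (∀ {x y} → x ∈ privateNeighbours G b a → y ∈ privateNeighbours G b a →
             x ≢ y → Adjacent G x y) →
  (∀ {x o} → x ∈ privateNeighbours G b a → Adjacent G a o → Adjacent G b o →
             Adjacent G x o) →
  length (privateNeighbours G a b) ≤ length (privateNeighbours G b a) →
  ColouringsExtend G a
colouringsExtend {m} {G} {a} {b} (a≢b , ab) clique complete fewer c colouring =
  recolourAt G a g-proper (g q) q-free
  where
  open GraphProperties G

  Q : List _
  Q = b ∷ privateNeighbours G b a

  lifted : Σ (Fin (suc m) → Fin c) (ProperAwayFrom G a)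
  lifted = liftColouring G a colouring (proj₁ colouring (punchOut a≢b))

  g : Fin (suc m) → Fin c
  g = proj₁ lifted

  g-proper : ProperAwayFrom G a g
  g-proper = proj₂ lifted

  Q-unique : Unique Q
  Q-unique = All.tabulate (λ x∈P → adjacent⇒≢ (proj₁ (∈-privateNeighbours⁻ x∈P)))
           ∷ privateNeighbours-unique b a

  Q-avoids-a : ∀ {x} → x ∈ Q → a ≢ x
  Q-avoids-a (here refl) = a≢b
  Q-avoids-a (there x∈P) = separated⇒≢ (adjacent-sym (proj₁ (∈-privateNeighbours⁻ x∈P))) ab

  Q-clique : ∀ {x y} → x ∈ Q → y ∈ Q → x ≢ y → Adjacent G x y
  Q-clique (here refl) (here refl) x≢y = contradiction refl x≢y
  Q-clique (here refl) (there y∈P) _   = proj₁ (∈-privateNeighbours⁻ y∈P)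
  Q-clique (there x∈P) (here refl) _   = adjacent-sym (proj₁ (∈-privateNeighbours⁻ x∈P))
  Q-clique (there x∈P) (there y∈P) x≢y = clique x∈P y∈P x≢y

  Q-complete : ∀ {x o} → x ∈ Q → Adjacent G a o → Adjacent G b o → Adjacent G x o
  Q-complete (here refl) _  bo = bo
  Q-complete (there x∈P) ao bo = complete x∈P ao bo

  chosen : ∃[ q ] q ∈ Q × (∀ {y} → y ∈ privateNeighbours G a b → g q ≢ g y)
  chosen = pigeonhole-∉ _≟_ g Q-unique
             (λ x∈Q y∈Q x≢y → g-proper (Q-avoids-a x∈Q) (Q-avoids-a y∈Q) (Q-clique x∈Q y∈Q x≢y))
             (s≤s fewer)
  q = proj₁ chosen
  q∈Q = proj₁ (proj₂ chosen)
  q-new = proj₂ (proj₂ chosen)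

  q-free : ∀ {v} → Adjacent G a v → g q ≢ g v
  q-free {v} av with adj G b v in bv
  ... | true  = g-proper (Q-avoids-a q∈Q) (adjacent⇒≢ av) (Q-complete q∈Q av bv)
  ... | false = q-new (∈-privateNeighbours⁺ av bv)

critical⇒¬ColouringsExtend : ∀ {m k} {G : Graph (suc m)} → VertexCritical G k →
                             ∀ a → ¬ ColouringsExtend G a
critical⇒¬ColouringsExtend ((_ , ¬colourable) , critical) a extend =
  let c , c<k , colouring = critical a in ¬colourable c c<k (extend c colouring)

module _ {n : ℕ} {G : Graph n} (free : P1+P3-Free G) where

  open GraphProperties G

  adjacent-by-freeness : ∀ {u v} → (NonAdjacent G u v → ContainsInduced P1+P3 G) →
                         Adjacent G u v
  adjacent-by-freeness {u} {v} induced with adj G u v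
  ... | true  = refl
  ... | false = ⊥-elim (free (induced refl))

  nonAdjacent-by-freeness : ∀ {u v} → (Adjacent G u v → ContainsInduced P1+P3 G) →
                            NonAdjacent G u v
  nonAdjacent-by-freeness {u} {v} induced with adj G u v
  ... | false = refl
  ... | true  = ⊥-elim (free (induced refl))

  module _ {a b c} (a∥b : Independent G a b) (a∥c : Independent G a c)
           (b∥c : Independent G b c) where

    private
      a≢b = proj₁ a∥b
      a≢c = proj₁ a∥c
      b≢c = proj₁ b∥c
      ab  = proj₂ a∥b
      ac  = proj₂ a∥c
      bc  = proj₂ b∥c

    private-clique : ∀ {x y} → x ∈ privateNeighbours G b a → y ∈ privateNeighbours G b a →
                     x ≢ y → Adjacent G x y
    private-clique x∈P y∈P x≢y =
      let bx , ax = ∈-privateNeighbours⁻ x∈P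
          by , ay = ∈-privateNeighbours⁻ y∈P
      in adjacent-by-freeness (induces-P1+P3 x≢y ax ab ay (adjacent-sym bx) by)

    commonNeighbour-adjacent : ∀ {o} → Adjacent G a o → Adjacent G b o → Adjacent G o c
    commonNeighbour-adjacent ao bo =
      adjacent-by-freeness λ oc →
        induces-P1+P3 a≢b (nonAdjacent-sym ac) (nonAdjacent-sym oc) (nonAdjacent-sym bc)
          ao (adjacent-sym bo) ab

    private-nonAdjacent : ∀ {x} → x ∈ privateNeighbours G b a → NonAdjacent G x c
    private-nonAdjacent x∈P =
      let bx , ax = ∈-privateNeighbours⁻ x∈P
      in nonAdjacent-by-freeness λ xc →
           induces-P1+P3 b≢c ab ax ac bx xc bc

    private-complete : ∀ {x o} → x ∈ privateNeighbours G b a → Adjacent G a o →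
                       Adjacent G b o → Adjacent G x o
    private-complete x∈P ao bo =
      adjacent-by-freeness λ xo →
        induces-P1+P3 a≢c (nonAdjacent-sym (proj₂ (∈-privateNeighbours⁻ x∈P))) xo
          (private-nonAdjacent x∈P) ao (commonNeighbour-adjacent ao bo) ac

noIndependentTriple : ∀ {n k} {G : Graph n} → VertexCritical G k → P1+P3-Free G →
                      NoIndependentTriple G
noIndependentTriple {zero} _ _ {()}
noIndependentTriple {suc m} {G = G} critical free {a} {b} {c} ab ac bc =
  [ ¬fewer a b c ab ac bc , ¬fewer b a c (independent-sym ab) bc ac ]′ (≤-total _ _)
  where
  open GraphProperties G

  ¬fewer : ∀ a b c → Independent G a b → Independent G a c → Independent G b c →
           length (privateNeighbours G a b) ≤ length (privateNeighbours G b a) → ⊥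
  ¬fewer a b c ab ac bc fewer = critical⇒¬ColouringsExtend {G = G} critical a
    (colouringsExtend {G = G} ab (private-clique {G = G} free ab ac bc)
                                 (private-complete {G = G} free ab ac bc) fewer)

critical⇒colourable : ∀ {n k} {G : Graph n} → VertexCritical G k → Colorable G k
critical⇒colourable {zero}  (colouring , _)     = colouring
critical⇒colourable {suc m} ((colouring , _) , _) = colouring

-- A vertex is sent to its colour and a bit recording whether an earlier
-- vertex has the same colour; a collision yields three vertices of one colour.
order≤colours*2 : ∀ {n k} {G : Graph n} → NoIndependentTriple G → Colorable G k → n ≤ k * 2
order≤colours*2 {n} {k} {G} noTriple colouring@(f , _) = injective⇒≤ {f = code} code-injective
  where
  open GraphProperties G

  Repeated : Fin n → Set
  Repeated v = ∃[ u ] u Fin.< v × f u ≡ f v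

  repeated? : Decidable Repeated
  repeated? v = any? (λ u → (u <? v) ×-dec (f u ≟ f v))

  bit : Fin n → Fin 2
  bit v with repeated? v
  ... | yes _ = 1F
  ... | no  _ = 0F

  bit-repeated : ∀ {v} → Repeated v → bit v ≡ 1F
  bit-repeated {v} r with repeated? v
  ... | yes _ = refl
  ... | no ¬r = contradiction r ¬r

  repeated-bit : ∀ {v} → bit v ≡ 1F → Repeated v
  repeated-bit {v} _ with repeated? v
  ... | yes r = r
  repeated-bit {v} () | no _

  code : Fin n → Fin (k * 2)
  code v = combine (f v) (bit v)

  ¬collision : ∀ {u v} → u Fin.< v → f u ≡ f v → bit u ≡ bit v → ⊥
  ¬collision {u} {v} u<v fu≡fv bu≡bv =
    let w , w<u , fw≡fu = repeated-bit (trans bu≡bv (bit-repeated (u , u<v , fu≡fv)))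
    in noTriple (sameColour⇒independent colouring (<⇒≢ w<u) fw≡fu)
                (sameColour⇒independent colouring (<⇒≢ (<-trans w<u u<v)) (trans fw≡fu fu≡fv))
                (sameColour⇒independent colouring (<⇒≢ u<v) fu≡fv)

  code-injective : ∀ {u v} → code u ≡ code v → u ≡ v
  code-injective {u} {v} eq with combine-injective (f u) (bit u) (f v) (bit v) eq | <-cmp u v
  ... | fu≡fv , bu≡bv | tri< u<v _ _ = ⊥-elim (¬collision u<v fu≡fv bu≡bv)
  ... | _             | tri≈ _ u≡v _ = u≡v
  ... | fu≡fv , bu≡bv | tri> _ _ v<u = ⊥-elim (¬collision v<u (≡-sym fu≡fv) (≡-sym bu≡bv))

vectors : ∀ {A : Set} → List A → (n : ℕ) → List (Vec A n)
vectors xs zero    = Vec.[] ∷ []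
vectors xs (suc n) = cartesianProductWith Vec._∷_ xs (vectors xs n)

∈-vectors : ∀ {A : Set} {xs : List A} → (∀ x → x ∈ xs) → ∀ {n} (v : Vec A n) → v ∈ vectors xs n
∈-vectors _     Vec.[]       = here refl
∈-vectors every (x Vec.∷ v) = ∈-cartesianProductWith⁺ Vec._∷_ (every x) (∈-vectors every v)

booleans : List Bool
booleans = true ∷ false ∷ []

∈-booleans : ∀ b → b ∈ booleans
∈-booleans true  = here refl
∈-booleans false = there (here refl)

Matrix : ℕ → Set
Matrix n = Vec (Vec Bool n) n

entry : ∀ {n} → Matrix n → Fin n → Fin n → Bool
entry M u v = Vec.lookup (Vec.lookup M u) v

-- Symmetrised and with the diagonal cleared, so that every Boolean matrix
-- is the adjacency matrix of some graph.
matrixAdj : ∀ {n} → Matrix n → Fin n → Fin n → Bool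
matrixAdj M u v with u ≟ v
... | yes _ = false
... | no  _ = entry M u v ∧ entry M v u

matrixAdj-sym : ∀ {n} (M : Matrix n) u v → matrixAdj M u v ≡ matrixAdj M v u
matrixAdj-sym M u v with u ≟ v | v ≟ u
... | yes _   | yes _   = refl
... | yes u≡v | no v≢u  = contradiction (≡-sym u≡v) v≢u
... | no u≢v  | yes v≡u = contradiction (≡-sym v≡u) u≢v
... | no _    | no _    = ∧-comm (entry M u v) (entry M v u)

matrixAdj-irrefl : ∀ {n} (M : Matrix n) v → matrixAdj M v v ≡ false
matrixAdj-irrefl M v with v ≟ v
... | yes _   = refl
... | no v≢v  = contradiction refl v≢v

fromMatrix : ∀ {n} → Matrix n → Graph n
fromMatrix M = record { adj = matrixAdj M ; sym = matrixAdj-sym M ; irrefl = matrixAdj-irrefl M }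

toMatrix : ∀ {n} → Graph n → Matrix n
toMatrix G = tabulate λ u → tabulate λ v → adj G u v

entry-toMatrix : ∀ {n} (G : Graph n) u v → entry (toMatrix G) u v ≡ adj G u v
entry-toMatrix G u v = begin
  Vec.lookup (Vec.lookup (toMatrix G) u) v  ≡⟨ cong (λ row → Vec.lookup row v) (lookup∘tabulate _ u) ⟩
  Vec.lookup (tabulate (adj G u)) v          ≡⟨ lookup∘tabulate _ v ⟩
  adj G u v                                  ∎
  where open ≡-Reasoning

adj-fromMatrix-toMatrix : ∀ {n} (G : Graph n) u v → adj G u v ≡ adj (fromMatrix (toMatrix G)) u v
adj-fromMatrix-toMatrix G u v with u ≟ v
... | yes refl = irrefl G u
... | no _     = ≡-sym (begin
  entry (toMatrix G) u v ∧ entry (toMatrix G) v u ≡⟨ cong₂ _∧_ (entry-toMatrix G u v) (entry-toMatrix G v u) ⟩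
  adj G u v ∧ adj G v u                         ≡⟨ cong (adj G u v ∧_) (sym G v u) ⟩
  adj G u v ∧ adj G u v                         ≡⟨ ∧-idem (adj G u v) ⟩
  adj G u v                                     ∎)
  where open ≡-Reasoning

graphsOfOrder : ℕ → List AnyGraph
graphsOfOrder n = map (λ M → n , fromMatrix M) (vectors (vectors booleans n) n)

graphsUpTo : ℕ → List AnyGraph
graphsUpTo N = concatMap graphsOfOrder (upTo (suc N))

graphsUpTo-complete : ∀ {N n} → n ≤ N → (G : Graph n) →
                      Σ AnyGraph λ H → (H ∈ graphsUpTo N) × Isomorphic G (proj₂ H)
graphsUpTo-complete {n = n} n≤N G =
  (n , fromMatrix (toMatrix G)) ,
  ∈-concatMap⁺ graphsOfOrder (lose (∈-upTo⁺ (s≤s n≤N))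
    (∈-map⁺ (λ M → n , fromMatrix M) (∈-vectors (∈-vectors ∈-booleans) (toMatrix G)))) ,
  ↔-id _ , adj-fromMatrix-toMatrix G

-- The order bound holds for every k.
theorem15 : (k : ℕ) → k ≥ 1 →
    Σ (List AnyGraph) λ L →
      ∀ {n} (G : Graph n) → VertexCritical G k → P1+P3-Free G →
        Σ AnyGraph λ H → (H ∈ L) × Isomorphic G (proj₂ H)
theorem15 k _ = graphsUpTo (k * 2) , λ G critical free →
  graphsUpTo-complete
    (order≤colours*2 {G = G} (noIndependentTriple critical free) (critical⇒colourable critical))
    G
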